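{- Let $n\ge 0$ and let $\frac{a}{b}$ and $\frac{c}{d}$ (in lowest terms, positive denominators) be consecutive terms of $SB_n$. If $9$ divides $bc-ad$, then either ($c\equiv a \pmod 9$ and $d\equiv b\pmod 9$) or ($a+c\equiv 0\pmod 9$ and $b+d\equiv 0 \pmod 9$).
   Context: The unit weight-$3$ Stern–Brocot sequences $SB_n$ ($n\ge0$) are defined as follows: $SB_0=(\frac{0}{1},\frac{1}{1})$, and $SB_{n+1}$ is obtained from $SB_n$ by keeping all its terms in order and inserting, between each pair of consecutive terms $\frac{p}{q},\frac{r}{s}$ (written in lowest terms with positive denominators), the two fractions $\frac{2p+r}{2q+s}$ and $\frac{p+2r}{q+2s}$, each reduced to lowest terms, in this order. All terms are written in lowest terms with positive denominator. -}

module Defs where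

open import Data.Nat using (ℕ; zero; suc; _+_; _*_; _/_; _%_)
open import Data.Nat.GCD using (gcd)
open import Data.Product using (_×_; _,_)
open import Data.List using (List; []; _∷_; _++_)

-- A fraction p/q is represented by the pair (p , q) of naturals (numerator,
-- denominator).  All terms of SB_n lie in [0,1], so numerators are >= 0 and
-- denominators are >= 1.

Frac : Set
Frac = ℕ × ℕ

-- exact division by the gcd; the gcd is nonzero whenever q > 0, which is
-- always the case for the fractions occurring below (the zero branch is
-- never used).
divBy : ℕ → ℕ → ℕ
divBy m zero    = m
divBy m (suc g) = m / suc g

reduce : Frac → Frac
reduce (p , q) = divBy p (gcd p q) , divBy q (gcd p q)

insert2 : Frac → Frac → List Frac
insert2 (p , q) (r , s) =
  reduce (2 * p + r , 2 * q + s) ∷ reduce (p + 2 * r , q + 2 * s) ∷ []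

step : List Frac → List Frac
step []            = []
step (x ∷ [])      = x ∷ []
step (x ∷ y ∷ xs)  = x ∷ insert2 x y ++ step (y ∷ xs)

SB : ℕ → List Frac
SB zero    = (0 , 1) ∷ (1 , 1) ∷ []
SB (suc n) = step (SB n)

{-# OPTIONS --safe #-}
-- Consecutive terms u = (a , b), v = (c , d) of SB n satisfy bc - ad = 3^k and v ≡ ±u (mod 3^k)
-- componentwise, for some k, and this survives refinement.  If v ≡ -u, the inserted vectors
-- 2u + v and u + 2v are already reduced, and the three new pairs have determinants 3^k, 3^(k+1),
-- 3^k with v ≡ +u, -u, +u respectively.  If v ≡ u and k ≥ 1, both inserted vectors are divisible
-- by 3, and after division all three new pairs have determinant 3^(k-1) and v ≡ +u.  New vectors
-- stay reduced because a common divisor of their entries divides the determinant, hence the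
-- modulus, hence the entries of the old neighbour.  So if 9 divides the determinant it divides
-- 3^k, and v ≡ ±u (mod 9).
module Submission where

open import Defs
open import Data.Nat using (ℕ; _+_; _%_)
open import Data.Integer using (ℤ; +_; _-_; _*_)
open import Data.Integer.Divisibility using (_∣_)
open import Data.Product using (_×_; _,_; ∃₂)
open import Data.Sum using (_⊎_)
open import Data.List using (List; _∷_; _++_)
open import Relation.Binary.PropositionalEquality using (_≡_)

import Data.Nat as ℕ
open import Data.Nat using (zero; suc; _^_; _≤_; _∸_; NonZero)
import Data.Nat.Properties as ℕ
open import Data.Nat.Divisibility using (divides; 1∣_; m∣m*n; ∣1⇒≡1; n∣m⇒m%n≡0)
  renaming (_∣_ to _∣ℕ_)
open import Data.Nat.DivMod using (n/1≡n; m*n/n≡m; [m+kn]%n≡m%n)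
open import Data.Nat.GCD using (gcd; gcd[m,n]∣m; gcd[m,n]∣n; gcd-greatest; c*gcd[m,n]≡gcd[cm,cn])
open import Data.Integer using (-_; ∣_∣) renaming (_+_ to _+ᶻ_)
import Data.Integer.Properties as ℤ
open import Data.Integer.Divisibility.Signed
  using (∣ᵤ⇒∣; ∣⇒∣ᵤ; ∣-refl; ∣-trans; ∣m∣n⇒∣m+n; ∣m∣n⇒∣m-n; ∣m⇒∣-m; ∣m⇒∣m*n; ∣n⇒∣m*n;
         *-monoʳ-∣; *-cancelˡ-∣)
  renaming (_∣_ to _∣ˢ_)
open import Data.Integer.Tactic.RingSolver using (solve-∀)
open import Data.Product using (proj₁; proj₂)
import Data.Product as Product
open import Data.Product.Properties using (,-injectiveˡ; ,-injectiveʳ)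
open import Data.Sum using (inj₁; inj₂)
import Data.Sum as Sum
open import Data.List using ([])
open import Data.List.Relation.Unary.Linked using (Linked; []; [-]; _∷_; head; tail)
open import Relation.Binary.Core using (Rel)
open import Relation.Binary.PropositionalEquality
  using (refl; sym; trans; cong; cong₂; subst; subst₂; module ≡-Reasoning)

pow3 : ℕ → ℤ
pow3 k = + (3 ^ k)

pow3-suc : ∀ k → pow3 (suc k) ≡ + 3 * pow3 k
pow3-suc k = ℤ.pos-* 3 (3 ^ k)

1∣ˢ_ : ∀ m → + 1 ∣ˢ m
1∣ˢ m = ∣ᵤ⇒∣ (1∣ ∣ m ∣)

pos-∣ : ∀ {m n} → m ∣ℕ n → + m ∣ˢ + n
pos-∣ = ∣ᵤ⇒∣

ℤ² : Set
ℤ² = ℤ × ℤ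

ι : Frac → ℤ²
ι (a , b) = + a , + b

Δ : ℤ² → ℤ² → ℤ
Δ (a , b) (c , d) = b * c - a * d

det : Frac → Frac → ℤ
det u v = Δ (ι u) (ι v)

mediantˡ mediantʳ : ℤ² → ℤ² → ℤ²
mediantˡ (a , b) (c , d) = + 2 * a +ᶻ c , + 2 * b +ᶻ d
mediantʳ (a , b) (c , d) = a +ᶻ + 2 * c , b +ᶻ + 2 * d

infixr 7 _·_

_·_ : ℤ → ℤ² → ℤ²
m · (a , b) = m * a , m * b

Reduced : Frac → Set
Reduced (a , b) = gcd a b ≡ 1

Congruent Opposite : ℤ → ℤ² → ℤ² → Set
Congruent M (a , b) (c , d) = M ∣ˢ c - a × M ∣ˢ d - b
Opposite  M (a , b) (c , d) = M ∣ˢ c +ᶻ a × M ∣ˢ d +ᶻ b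

record Adjacent (u v : Frac) : Set where
  constructor adjacent
  field
    level     : ℕ
    det≡pow3  : det u v ≡ pow3 level
    congruent : Congruent (pow3 level) (ι u) (ι v) ⊎ Opposite (pow3 level) (ι u) (ι v)
    reducedˡ  : Reduced u
    reducedʳ  : Reduced v

Congruent-sym : ∀ {M U V} → Congruent M U V → Congruent M V U
Congruent-sym {M} {a , b} {c , d} (m₁ , m₂) = flip a c m₁ , flip b d m₂
  where
  -[y-x]≡x-y : ∀ x y → - (y - x) ≡ x - y
  -[y-x]≡x-y = solve-∀
  flip : ∀ x y → M ∣ˢ y - x → M ∣ˢ x - y
  flip x y m = subst (M ∣ˢ_) (-[y-x]≡x-y x y) (∣m⇒∣-m m)

gcd∣detˡ : ∀ a b c d → + gcd a b ∣ˢ det (a , b) (c , d)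
gcd∣detˡ a b c d =
  ∣m∣n⇒∣m-n (∣m⇒∣m*n (+ c) (pos-∣ (gcd[m,n]∣n a b))) (∣m⇒∣m*n (+ d) (pos-∣ (gcd[m,n]∣m a b)))

gcd∣detʳ : ∀ a b c d → + gcd c d ∣ˢ det (a , b) (c , d)
gcd∣detʳ a b c d =
  ∣m∣n⇒∣m-n (∣n⇒∣m*n (+ b) (pos-∣ (gcd[m,n]∣m c d))) (∣n⇒∣m*n (+ a) (pos-∣ (gcd[m,n]∣n c d)))

reduced-transfer : ∀ {M} a b c d → Reduced (a , b) → + gcd c d ∣ˢ M →
                   Congruent M (ι (a , b)) (ι (c , d)) → Reduced (c , d)
reduced-transfer {M} a b c d ab g∣M (m₁ , m₂) =
  ∣1⇒≡1 (subst (gcd c d ∣ℕ_) ab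
    (gcd-greatest {a} {b} (back (gcd[m,n]∣m c d) m₁) (back (gcd[m,n]∣n c d) m₂)))
  where
  x-[x-y]≡y : ∀ x y → x - (x - y) ≡ y
  x-[x-y]≡y = solve-∀
  back : ∀ {x y} → gcd c d ∣ℕ x → M ∣ˢ + x - + y → gcd c d ∣ℕ y
  back {x} {y} g∣x M∣x-y =
    ∣⇒∣ᵤ (subst (+ gcd c d ∣ˢ_) (x-[x-y]≡y (+ x) (+ y)) (∣m∣n⇒∣m-n (pos-∣ g∣x) (∣-trans g∣M M∣x-y)))

adjacent-from-left : ∀ {u v} k → Reduced u → det u v ≡ pow3 k →
                     Congruent (pow3 k) (ι u) (ι v) → Adjacent u v
adjacent-from-left {a , b} {c , d} k ru det≡ cg =
  adjacent k det≡ (inj₁ cg) ru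
    (reduced-transfer a b c d ru (subst (_ ∣ˢ_) det≡ (gcd∣detʳ a b c d)) cg)

adjacent-from-right : ∀ {u v} k → Reduced v → det u v ≡ pow3 k →
                      Congruent (pow3 k) (ι u) (ι v) → Adjacent u v
adjacent-from-right {a , b} {c , d} k rv det≡ cg =
  adjacent k det≡ (inj₁ cg)
    (reduced-transfer c d a b rv (subst (_ ∣ˢ_) det≡ (gcd∣detˡ a b c d))
      (Congruent-sym {U = ι (a , b)} {ι (c , d)} cg))
    rv

reduce-reduced : ∀ {p q} → Reduced (p , q) → reduce (p , q) ≡ (p , q)
reduce-reduced {p} {q} r =
  trans (cong (λ g → divBy p g , divBy q g) r) (cong₂ _,_ (n/1≡n p) (n/1≡n q))

reduce-scale : ∀ m {p q} → Reduced (p , q) → reduce (suc m ℕ.* p , suc m ℕ.* q) ≡ (p , q)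
reduce-scale m {p} {q} r =
  trans (cong (λ g → divBy (suc m ℕ.* p) g , divBy (suc m ℕ.* q) g) gcd≡)
        (cong₂ _,_ (cancel p) (cancel q))
  where
  gcd≡ : gcd (suc m ℕ.* p) (suc m ℕ.* q) ≡ suc m
  gcd≡ = trans (sym (c*gcd[m,n]≡gcd[cm,cn] (suc m) p q))
               (trans (cong (suc m ℕ.*_) r) (ℕ.*-identityʳ (suc m)))
  cancel : ∀ x → suc m ℕ.* x ℕ./ suc m ≡ x
  cancel x = trans (cong (ℕ._/ suc m) (ℕ.*-comm (suc m) x)) (m*n/n≡m x (suc m))

reduce-thirds : ∀ {p q} x y → p ≡ x ℕ.* 3 → q ≡ y ℕ.* 3 → Reduced (x , y) →
                reduce (p , q) ≡ (x , y)
reduce-thirds x y refl refl r =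
  trans (cong reduce (cong₂ _,_ (ℕ.*-comm x 3) (ℕ.*-comm y 3))) (reduce-scale 2 r)

pos-2m+n : ∀ m n → + (2 ℕ.* m + n) ≡ + 2 * + m +ᶻ + n
pos-2m+n m n = trans (ℤ.pos-+ (2 ℕ.* m) n) (cong (_+ᶻ + n) (ℤ.pos-* 2 m))

pos-m+2n : ∀ m n → + (m + 2 ℕ.* n) ≡ + m +ᶻ + 2 * + n
pos-m+2n m n = trans (ℤ.pos-+ m (2 ℕ.* n)) (cong (+ m +ᶻ_) (ℤ.pos-* 2 n))

pos-third : ∀ {n e} x → n ≡ x ℕ.* 3 → + n ≡ e → + 3 * + x ≡ e
pos-third x refl +n≡ = trans (sym (ℤ.pos-* 3 x)) (trans (cong +_ (ℕ.*-comm 3 x)) +n≡)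

ι-mediantˡ : ∀ a b c d → ι (2 ℕ.* a + c , 2 ℕ.* b + d) ≡ mediantˡ (ι (a , b)) (ι (c , d))
ι-mediantˡ a b c d = cong₂ _,_ (pos-2m+n a c) (pos-2m+n b d)

ι-mediantʳ : ∀ a b c d → ι (a + 2 ℕ.* c , b + 2 ℕ.* d) ≡ mediantʳ (ι (a , b)) (ι (c , d))
ι-mediantʳ a b c d = cong₂ _,_ (pos-m+2n a c) (pos-m+2n b d)

Δ-mediants : ∀ {U V X Z} → X ≡ mediantˡ U V → Z ≡ mediantʳ U V →
             Δ U X ≡ Δ U V × Δ X Z ≡ + 3 * Δ U V × Δ Z V ≡ Δ U V
Δ-mediants {a , b} {c , d} refl refl = left a b c d , middle a b c d , right a b c d
  where
  left : ∀ a b c d → b * (+ 2 * a +ᶻ c) - a * (+ 2 * b +ᶻ d) ≡ b * c - a * d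
  left = solve-∀
  middle : ∀ a b c d →
           (+ 2 * b +ᶻ d) * (a +ᶻ + 2 * c) - (+ 2 * a +ᶻ c) * (b +ᶻ + 2 * d) ≡ + 3 * (b * c - a * d)
  middle = solve-∀
  right : ∀ a b c d → (b +ᶻ + 2 * d) * c - (a +ᶻ + 2 * c) * d ≡ b * c - a * d
  right = solve-∀

Δ-·ˡ : ∀ m U V → Δ (m · U) V ≡ m * Δ U V
Δ-·ˡ m (a , b) (c , d) = identity m a b c d
  where
  identity : ∀ m a b c d → (m * b) * c - (m * a) * d ≡ m * (b * c - a * d)
  identity = solve-∀

Δ-·ʳ : ∀ m U V → Δ U (m · V) ≡ m * Δ U V
Δ-·ʳ m (a , b) (c , d) = identity m a b c d
  where
  identity : ∀ m a b c d → b * (m * c) - a * (m * d) ≡ m * (b * c - a * d)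
  identity = solve-∀

Δ-thirds : ∀ {δ U V X Z} → + 3 · X ≡ mediantˡ U V → + 3 · Z ≡ mediantʳ U V → Δ U V ≡ + 3 * δ →
           Δ U X ≡ δ × Δ X Z ≡ δ × Δ Z V ≡ δ
Δ-thirds {δ} {U} {V} {X} {Z} eqX eqZ Δ≡ with Δ-mediants {U} {V} eqX eqZ
... | left , middle , right =
  cancel (trans (sym (Δ-·ʳ (+ 3) U X)) (trans left Δ≡)) ,
  cancel (cancel (begin
    + 3 * (+ 3 * Δ X Z)     ≡⟨ cong (+ 3 *_) (Δ-·ʳ (+ 3) X Z) ⟨
    + 3 * Δ X (+ 3 · Z)     ≡⟨ Δ-·ˡ (+ 3) X (+ 3 · Z) ⟨
    Δ (+ 3 · X) (+ 3 · Z)   ≡⟨ middle ⟩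
    + 3 * Δ U V             ≡⟨ cong (+ 3 *_) Δ≡ ⟩
    + 3 * (+ 3 * δ)         ∎)) ,
  cancel (trans (sym (Δ-·ˡ (+ 3) Z V)) (trans right Δ≡))
  where
  open ≡-Reasoning
  cancel : ∀ {x y} → + 3 * x ≡ + 3 * y → x ≡ y
  cancel = ℤ.*-cancelˡ-≡ (+ 3) _ _

mediants-of-opposite : ∀ {M U V X Z} → X ≡ mediantˡ U V → Z ≡ mediantʳ U V → Opposite M U V →
                       Congruent M U X × Opposite (+ 3 * M) X Z × Congruent M Z V
mediants-of-opposite {M} {a , b} {c , d} refl refl (m₁ , m₂) =
  (left a c m₁ , left b d m₂) , (middle a c m₁ , middle b d m₂) , (right a c m₁ , right b d m₂)
  where
  left-identity : ∀ a c → c +ᶻ a ≡ (+ 2 * a +ᶻ c) - a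
  left-identity = solve-∀
  middle-identity : ∀ a c → + 3 * (c +ᶻ a) ≡ (a +ᶻ + 2 * c) +ᶻ (+ 2 * a +ᶻ c)
  middle-identity = solve-∀
  right-identity : ∀ a c → - (c +ᶻ a) ≡ c - (a +ᶻ + 2 * c)
  right-identity = solve-∀
  left : ∀ a c → M ∣ˢ c +ᶻ a → M ∣ˢ (+ 2 * a +ᶻ c) - a
  left a c = subst (M ∣ˢ_) (left-identity a c)
  middle : ∀ a c → M ∣ˢ c +ᶻ a → + 3 * M ∣ˢ (a +ᶻ + 2 * c) +ᶻ (+ 2 * a +ᶻ c)
  middle a c m = subst (+ 3 * M ∣ˢ_) (middle-identity a c) (*-monoʳ-∣ (+ 3) m)
  right : ∀ a c → M ∣ˢ c +ᶻ a → M ∣ˢ c - (a +ᶻ + 2 * c)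
  right a c m = subst (M ∣ˢ_) (right-identity a c) (∣m⇒∣-m m)

3*-difference : ∀ {x y p q} → + 3 * x ≡ p → + 3 * y ≡ q → + 3 * (x - y) ≡ p - q
3*-difference {x} {y} refl refl = identity x y
  where
  identity : ∀ x y → + 3 * (x - y) ≡ + 3 * x - + 3 * y
  identity = solve-∀

thirds-∣-differences : ∀ {j a c x z} → + 3 * x ≡ + 2 * a +ᶻ c → + 3 * z ≡ a +ᶻ + 2 * c → pow3 (suc j) ∣ˢ c - a →
         pow3 j ∣ˢ x - a × pow3 j ∣ˢ z - x × pow3 j ∣ˢ c - z
thirds-∣-differences {j} {a} {c} eqx eqz m =
  third (trans (3*-difference {y = a} eqx refl) (left a c)) ,
  third (trans (3*-difference eqz eqx) (middle a c)) ,
  third (trans (3*-difference {c} refl eqz) (right a c))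
  where
  left : ∀ a c → (+ 2 * a +ᶻ c) - + 3 * a ≡ c - a
  left = solve-∀
  middle : ∀ a c → (a +ᶻ + 2 * c) - (+ 2 * a +ᶻ c) ≡ c - a
  middle = solve-∀
  right : ∀ a c → + 3 * c - (a +ᶻ + 2 * c) ≡ c - a
  right = solve-∀
  third : ∀ {t} → + 3 * t ≡ c - a → pow3 j ∣ˢ t
  third eq = *-cancelˡ-∣ (+ 3) (subst₂ _∣ˢ_ (pow3-suc j) (sym eq) m)

mediants-of-congruent : ∀ {j U V X Z} → + 3 · X ≡ mediantˡ U V → + 3 · Z ≡ mediantʳ U V →
                        Congruent (pow3 (suc j)) U V →
                        Congruent (pow3 j) U X × Congruent (pow3 j) X Z × Congruent (pow3 j) Z V
mediants-of-congruent {j} {a , b} {c , d} {x , y} {z , w} eqX eqZ (m₁ , m₂) =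
  (proj₁ t₁ , proj₁ t₂) ,
  (proj₁ (proj₂ t₁) , proj₁ (proj₂ t₂)) ,
  (proj₂ (proj₂ t₁) , proj₂ (proj₂ t₂))
  where
  t₁ : pow3 j ∣ˢ x - a × pow3 j ∣ˢ z - x × pow3 j ∣ˢ c - z
  t₁ = thirds-∣-differences {j} {a} {c} {x} {z} (,-injectiveˡ eqX) (,-injectiveˡ eqZ) m₁
  t₂ : pow3 j ∣ˢ y - b × pow3 j ∣ˢ w - y × pow3 j ∣ˢ d - w
  t₂ = thirds-∣-differences {j} {b} {d} {y} {w} (,-injectiveʳ eqX) (,-injectiveʳ eqZ) m₂

3∣mediants : ∀ {j} a c → pow3 (suc j) ∣ˢ + c - + a → 3 ∣ℕ 2 ℕ.* a + c × 3 ∣ℕ a + 2 ℕ.* c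
3∣mediants {j} a c m =
  ∣⇒∣ᵤ (subst (+ 3 ∣ˢ_) (trans (left (+ a) (+ c)) (sym (pos-2m+n a c)))
                       (∣m∣n⇒∣m+n (∣m⇒∣m*n (+ a) ∣-refl) 3∣c-a)) ,
  ∣⇒∣ᵤ (subst (+ 3 ∣ˢ_) (trans (right (+ a) (+ c)) (sym (pos-m+2n a c)))
                       (∣m∣n⇒∣m-n (∣m⇒∣m*n (+ c) ∣-refl) 3∣c-a))
  where
  left : ∀ a c → + 3 * a +ᶻ (c - a) ≡ + 2 * a +ᶻ c
  left = solve-∀
  right : ∀ a c → + 3 * c - (c - a) ≡ a +ᶻ + 2 * c
  right = solve-∀
  3∣c-a : + 3 ∣ˢ + c - + a
  3∣c-a = ∣-trans (pos-∣ (m∣m*n (3 ^ j))) m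

reduce-linked : ∀ {u x z v} x′ z′ → (Reduced x → reduce x′ ≡ x) → (Reduced z → reduce z′ ≡ z) →
                Linked Adjacent (u ∷ x ∷ z ∷ v ∷ []) →
                Linked Adjacent (u ∷ reduce x′ ∷ reduce z′ ∷ v ∷ [])
reduce-linked x′ z′ rx rz (ux ∷ xz ∷ zv ∷ [-])
  with rx (Adjacent.reducedʳ ux) | rz (Adjacent.reducedˡ zv)
... | refl | refl = ux ∷ xz ∷ zv ∷ [-]

opposite-mediants-adjacent :
  ∀ {a b c d} k → det (a , b) (c , d) ≡ pow3 k → Opposite (pow3 k) (ι (a , b)) (ι (c , d)) →
  Reduced (a , b) → Reduced (c , d) →
  Linked Adjacent ((a , b) ∷ (2 ℕ.* a + c , 2 ℕ.* b + d) ∷ (a + 2 ℕ.* c , b + 2 ℕ.* d) ∷ (c , d) ∷ [])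
opposite-mediants-adjacent {a} {b} {c} {d} k det≡ opp ru rv
  with Δ-mediants {ι (a , b)} {ι (c , d)} (ι-mediantˡ a b c d) (ι-mediantʳ a b c d)
     | mediants-of-opposite {pow3 k} {ι (a , b)} {ι (c , d)}
         (ι-mediantˡ a b c d) (ι-mediantʳ a b c d) opp
... | Δˡ , Δᵐ , Δʳ | congˡ , oppᵐ , congʳ = ux ∷ xz ∷ zv ∷ [-]
  where
  x z : Frac
  x = 2 ℕ.* a + c , 2 ℕ.* b + d
  z = a + 2 ℕ.* c , b + 2 ℕ.* d
  ux : Adjacent (a , b) x
  ux = adjacent-from-left k ru (trans Δˡ det≡) congˡ
  zv : Adjacent z (c , d)
  zv = adjacent-from-right k rv (trans Δʳ det≡) congʳ
  xz : Adjacent x z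
  xz = adjacent (suc k)
         (trans Δᵐ (trans (cong (+ 3 *_) det≡) (sym (pow3-suc k))))
         (inj₂ (subst (λ M → Opposite M (ι x) (ι z)) (sym (pow3-suc k)) oppᵐ))
         (Adjacent.reducedʳ ux) (Adjacent.reducedˡ zv)

congruent-thirds-adjacent :
  ∀ {a b c d x y z w} j →
  2 ℕ.* a + c ≡ x ℕ.* 3 → 2 ℕ.* b + d ≡ y ℕ.* 3 → a + 2 ℕ.* c ≡ z ℕ.* 3 → b + 2 ℕ.* d ≡ w ℕ.* 3 →
  det (a , b) (c , d) ≡ pow3 (suc j) → Congruent (pow3 (suc j)) (ι (a , b)) (ι (c , d)) →
  Reduced (a , b) → Reduced (c , d) →
  Linked Adjacent ((a , b) ∷ (x , y) ∷ (z , w) ∷ (c , d) ∷ [])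
congruent-thirds-adjacent {a} {b} {c} {d} {x} {y} {z} {w} j ex ey ez ew det≡ cg ru rv =
  ux ∷ xz ∷ zv ∷ [-]
  where
  U V X Z : ℤ²
  U = ι (a , b)
  V = ι (c , d)
  X = ι (x , y)
  Z = ι (z , w)
  eqX : + 3 · X ≡ mediantˡ U V
  eqX = cong₂ _,_ (pos-third x ex (pos-2m+n a c)) (pos-third y ey (pos-2m+n b d))
  eqZ : + 3 · Z ≡ mediantʳ U V
  eqZ = cong₂ _,_ (pos-third z ez (pos-m+2n a c)) (pos-third w ew (pos-m+2n b d))
  dets : Δ U X ≡ pow3 j × Δ X Z ≡ pow3 j × Δ Z V ≡ pow3 j
  dets = Δ-thirds {U = U} {V} eqX eqZ (trans det≡ (pow3-suc j))
  congs : Congruent (pow3 j) U X × Congruent (pow3 j) X Z × Congruent (pow3 j) Z V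
  congs = mediants-of-congruent {j} {U} {V} eqX eqZ cg
  ux : Adjacent (a , b) (x , y)
  ux = adjacent-from-left j ru (proj₁ dets) (proj₁ congs)
  zv : Adjacent (z , w) (c , d)
  zv = adjacent-from-right j rv (proj₂ (proj₂ dets)) (proj₂ (proj₂ congs))
  xz : Adjacent (x , y) (z , w)
  xz = adjacent j (proj₁ (proj₂ dets)) (inj₁ (proj₁ (proj₂ congs)))
         (Adjacent.reducedʳ ux) (Adjacent.reducedˡ zv)

adjacent-split : ∀ {u v} → Adjacent u v → Linked Adjacent (u ∷ insert2 u v ++ v ∷ [])
adjacent-split {a , b} {c , d} (adjacent k det≡ (inj₂ opp) ru rv) =
  reduce-linked (2 ℕ.* a + c , 2 ℕ.* b + d) (a + 2 ℕ.* c , b + 2 ℕ.* d)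
    reduce-reduced reduce-reduced (opposite-mediants-adjacent k det≡ opp ru rv)
adjacent-split {a , b} {c , d} (adjacent zero det≡ (inj₁ _) ru rv) =
  reduce-linked (2 ℕ.* a + c , 2 ℕ.* b + d) (a + 2 ℕ.* c , b + 2 ℕ.* d)
    reduce-reduced reduce-reduced
    (opposite-mediants-adjacent zero det≡ (1∣ˢ _ , 1∣ˢ _) ru rv)
adjacent-split {a , b} {c , d} (adjacent (suc j) det≡ (inj₁ cg) ru rv) =
  split-thirds (3∣mediants {j} a c (proj₁ cg)) (3∣mediants {j} b d (proj₂ cg))
  where
  split-thirds : 3 ∣ℕ 2 ℕ.* a + c × 3 ∣ℕ a + 2 ℕ.* c → 3 ∣ℕ 2 ℕ.* b + d × 3 ∣ℕ b + 2 ℕ.* d →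
                 Linked Adjacent ((a , b) ∷ insert2 (a , b) (c , d) ++ (c , d) ∷ [])
  split-thirds (divides x ex , divides z ez) (divides y ey , divides w ew) =
    reduce-linked (2 ℕ.* a + c , 2 ℕ.* b + d) (a + 2 ℕ.* c , b + 2 ℕ.* d)
      (reduce-thirds x y ex ey) (reduce-thirds z w ez ew)
      (congruent-thirds-adjacent j ex ey ez ew det≡ cg ru rv)

module _ {ℓ} {R : Rel Frac ℓ} where

  step-Linked : (∀ {u v} → R u v → Linked R (u ∷ insert2 u v ++ v ∷ [])) →
                ∀ {xs} → Linked R xs → Linked R (step xs)
  step-Linked split []                  = []
  step-Linked split [-]                 = [-]
  step-Linked split {x ∷ y ∷ xs} (r ∷ rs) with split r
  ... | r₁ ∷ r₂ ∷ r₃ ∷ [-] = r₁ ∷ r₂ ∷ ∷-step xs r₃ (step-Linked split rs)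
    where
    ∷-step : ∀ {q y} xs → R q y → Linked R (step (y ∷ xs)) → Linked R (q ∷ step (y ∷ xs))
    ∷-step []      r rs = r ∷ rs
    ∷-step (_ ∷ _) r rs = r ∷ rs

Linked-middle : ∀ {a ℓ} {A : Set a} {R : Rel A ℓ} xs {u v ys} →
                Linked R (xs ++ u ∷ v ∷ ys) → R u v
Linked-middle []       l = head l
Linked-middle (_ ∷ xs) l = Linked-middle xs (tail l)

SB-Linked : ∀ n → Linked Adjacent (SB n)
SB-Linked zero    = adjacent 0 refl (inj₁ (1∣ˢ _ , 1∣ˢ _)) refl refl ∷ [-]
SB-Linked (suc n) = step-Linked adjacent-split (SB-Linked n)

Adjacent-∣det : ∀ {u v M} → Adjacent u v → M ∣ˢ det u v →
                Congruent M (ι u) (ι v) ⊎ Opposite M (ι u) (ι v)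
Adjacent-∣det {M = M} (adjacent k det≡ cg _ _) M∣det = Sum.map weaken weaken cg
  where
  weaken : ∀ {x y} → pow3 k ∣ˢ x × pow3 k ∣ˢ y → M ∣ˢ x × M ∣ˢ y
  weaken = Product.map (∣-trans (subst (M ∣ˢ_) det≡ M∣det)) (∣-trans (subst (M ∣ˢ_) det≡ M∣det))

∣∸⇒%≡ : ∀ {n a c} .{{_ : NonZero n}} → a ≤ c → n ∣ℕ c ∸ a → c % n ≡ a % n
∣∸⇒%≡ {n} {a} {c} a≤c (divides q c∸a≡) = begin
  c % n                ≡⟨ cong (_% n) (ℕ.m+[n∸m]≡n a≤c) ⟨
  (a + (c ∸ a)) % n    ≡⟨ cong (λ t → (a + t) % n) c∸a≡ ⟩
  (a + q ℕ.* n) % n    ≡⟨ [m+kn]%n≡m%n a q n ⟩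
  a % n                ∎
  where open ≡-Reasoning

congruent⇒%≡ : ∀ {n} .{{_ : NonZero n}} a c → + n ∣ˢ + c - + a → c % n ≡ a % n
congruent⇒%≡ {n} a c m with ℕ.≤-total a c
... | inj₁ a≤c = ∣∸⇒%≡ a≤c (subst (n ∣ℕ_) ∣c-a∣≡c∸a (∣⇒∣ᵤ m))
  where
  ∣c-a∣≡c∸a : ∣ + c - + a ∣ ≡ c ∸ a
  ∣c-a∣≡c∸a = trans (cong ∣_∣ (ℤ.m-n≡m⊖n c a)) (trans (ℤ.∣m⊖n∣≡∣n⊖m∣ c a) (ℤ.∣⊖∣-≤ a≤c))
... | inj₂ c≤a = sym (∣∸⇒%≡ c≤a (subst (n ∣ℕ_) ∣c-a∣≡a∸c (∣⇒∣ᵤ m)))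
  where
  ∣c-a∣≡a∸c : ∣ + c - + a ∣ ≡ a ∸ c
  ∣c-a∣≡a∸c = trans (cong ∣_∣ (ℤ.m-n≡m⊖n c a)) (ℤ.∣⊖∣-≤ c≤a)

opposite⇒%≡0 : ∀ {n} .{{_ : NonZero n}} a c → + n ∣ˢ + c +ᶻ + a → (a + c) % n ≡ 0
opposite⇒%≡0 {n} a c m =
  n∣m⇒m%n≡0 (a + c) n
    (subst (n ∣ℕ_) (ℕ.+-comm c a) (∣⇒∣ᵤ (subst (+ n ∣ˢ_) (sym (ℤ.pos-+ c a)) m)))

lemma7 : (n a b c d : ℕ) →
    (∃₂ λ (xs ys : List Frac) → SB n ≡ xs ++ (a , b) ∷ (c , d) ∷ ys) →
    (+ 9) ∣ ((+ b) * (+ c) - (+ a) * (+ d)) →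
    ((c % 9 ≡ a % 9) × (d % 9 ≡ b % 9)) ⊎ (((a + c) % 9 ≡ 0) × ((b + d) % 9 ≡ 0))
lemma7 n a b c d (xs , ys , SB≡) 9∣det
  with Adjacent-∣det (Linked-middle xs (subst (Linked Adjacent) SB≡ (SB-Linked n)))
                     (∣ᵤ⇒∣ {+ 9} {det (a , b) (c , d)} 9∣det)
... | inj₁ (m₁ , m₂) = inj₁ (congruent⇒%≡ a c m₁ , congruent⇒%≡ b d m₂)
... | inj₂ (m₁ , m₂) = inj₂ (opposite⇒%≡0 a c m₁ , opposite⇒%≡0 b d m₂)
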